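{- Let $1 \leq t \leq k$ and $m \geq 2k-t$ be integers. Let $\mathcal F$ be a $t$-intersecting family of $k$-multisets of $[m]$. Let $T \in \mathcal K(\mathcal F)$ and let $i \in [m]$ with $i \in T_{>1}$, and set $s = \mathrm{m}(i,T)$. Define \[\widehat{\mathcal F} = \mathcal S_{(i,s)(m)}\Big[\mathcal S_{(i,s)(m-1)}\big[\cdots\big[\mathcal S_{(i,s)(1)}(\mathcal F)\big]\cdots\big]\Big].\] If $\widehat{\mathcal F}$ is the collection of all $k$-multisets of $[m]$ containing a fixed $t$-multiset, then $\mathcal F$ is the collection of all $k$-multisets of $[m]$ containing a fixed $t$-multiset.
   Context: A $k$-multiset of $[m]=\{1,\dots,m\}$ is a multiset of cardinality $k$ (counting repetitions) with elements from $[m]$; $\mathrm{m}(i,A)$ is the multiplicity of $i$ in $A$. The intersection $A\cap B$ of multisets has multiplicities $\min\{\mathrm{m}(i,A),\mathrm{m}(i,B)\}$; sets are multisets with all multiplicities one; $X\subseteq A$ for multisets means $\mathrm{m}(i,X)\le\mathrm{m}(i,A)$ for all $i$. A family is $t$-intersecting if $|A\cap B|\ge t$ for all members $A,B$. A multiset $T$ (elements from $[m]$, any size) is a $t$-kernel for $\mathcal F$ if $|F_1\cap F_2\cap T|\ge t$ for all $F_1,F_2\in\mathcal F$; $\mathcal K(\mathcal F)$ is the set of $t$-kernels $T$ for $\mathcal F$ with $[m]\subseteq T$. $T_{>1}$ is the multiset difference $T\setminus[m]$, so $i\in T_{>1}$ means $\mathrm{m}(i,T)\ge 2$. For a multiset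 $F$, $s\ge1$ and $j\in[m]$: if $s\le \mathrm{m}(i,F)$ and $j\notin F$, $F_{(i,s)(j)}$ is obtained from $F$ by replacing all but $s-1$ copies of $i$ by copies of $j$ (so $i$ has multiplicity $s-1$, $j$ has multiplicity $\mathrm{m}(i,F)-s+1$, others unchanged); if $s>\mathrm{m}(i,F)$, $F_{(i,s)(j)}=F$. For a family $\mathcal F$, $\mathcal S_{(i,s)(j)}(\mathcal F)=\{\mathcal S_{(i,s)(j)}(F): F\in\mathcal F\}$, where $\mathcal S_{(i,s)(j)}(F)=F_{(i,s)(j)}$ if $j\notin F$ and $F_{(i,s)(j)}\notin\mathcal F$, and $\mathcal S_{(i,s)(j)}(F)=F$ otherwise. -}

module Defs where

open import Data.Nat using (ℕ; _≤_; _∸_; _⊓_; _≟_; _≤?_)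
open import Data.Fin using (Fin)
open import Data.Vec using (Vec; lookup; zipWith; sum; _[_]≔_)
import Data.Vec.Properties as VP
open import Data.List using (List; map; foldl; allFin)
open import Data.List.Relation.Unary.All using (All)
open import Data.Product using (_×_)
open import Relation.Binary.PropositionalEquality using (_≡_)
open import Relation.Binary.Definitions using (DecidableEquality)
open import Relation.Nullary using (yes; no; ¬_)
import Relation.Nullary

-- A multiset with elements from [m] = Fin m, given by its multiplicity vector.
Multiset : ℕ → Set
Multiset m = Vec ℕ m

mult : ∀ {m} → Fin m → Multiset m → ℕ
mult i A = lookup A i

card : ∀ {m} → Multiset m → ℕ
card A = sum A

_∩_ : ∀ {m} → Multiset m → Multiset m → Multiset m
A ∩ B = zipWith _⊓_ A B

_⊆ₘ_ : ∀ {m} → Multiset m → Multiset m → Set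
X ⊆ₘ A = ∀ i → mult i X ≤ mult i A

_≟ₘ_ : ∀ {m} → DecidableEquality (Multiset m)
_≟ₘ_ = VP.≡-dec _≟_

-- A (finite) family of multisets of [m], as a list (duplicates irrelevant;
-- membership is propositional list membership).
Family : ℕ → Set
Family m = List (Multiset m)

open import Data.List.Membership.Propositional public using (_∈_; _∉_)
import Data.List.Membership.DecPropositional as DecMem

_∈?_ : ∀ {m} (A : Multiset m) (𝓕 : Family m) → Relation.Nullary.Dec (A ∈ 𝓕)
_∈?_ {m} = DecMem._∈?_ (_≟ₘ_ {m})

IsKFamily : ∀ {m} → ℕ → Family m → Set
IsKFamily k 𝓕 = All (λ A → card A ≡ k) 𝓕

IsTIntersecting : ∀ {m} → ℕ → Family m → Set
IsTIntersecting t 𝓕 = ∀ {A B} → A ∈ 𝓕 → B ∈ 𝓕 → t ≤ card (A ∩ B)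

IsKernel : ∀ {m} → ℕ → Family m → Multiset m → Set
IsKernel t 𝓕 T = ∀ {F₁ F₂} → F₁ ∈ 𝓕 → F₂ ∈ 𝓕 → t ≤ card ((F₁ ∩ F₂) ∩ T)

-- T ∈ 𝒦(𝓕): t-kernel with [m] ⊆ T
InK : ∀ {m} → ℕ → Family m → Multiset m → Set
InK {m} t 𝓕 T = IsKernel t 𝓕 T × (∀ (i : Fin m) → 1 ≤ mult i T)

-- F_{(i,s)(j)}: if s ≤ m(i,F) and j ∉ F, i gets multiplicity s-1 and j gets
-- m(i,F)-s+1; otherwise (s > m(i,F), or the undefined case j ∈ F, which is
-- never used by the shifting operator) F is returned unchanged.
shiftM : ∀ {m} → Fin m → ℕ → Fin m → Multiset m → Multiset m
shiftM i s j F with s ≤? mult i F | mult j F ≟ 0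
... | yes _ | yes _ = (F [ i ]≔ (s ∸ 1)) [ j ]≔ (mult i F ∸ (s ∸ 1))
... | _     | _     = F

shiftOne : ∀ {m} → Fin m → ℕ → Fin m → Family m → Multiset m → Multiset m
shiftOne i s j 𝓕 F with mult j F ≟ 0 | shiftM i s j F ∈? 𝓕
... | yes _ | no _ = shiftM i s j F
... | _     | _    = F

shiftFam : ∀ {m} → Fin m → ℕ → Fin m → Family m → Family m
shiftFam i s j 𝓕 = map (shiftOne i s j 𝓕) 𝓕

-- 𝒮_{(i,s)(m)}[ ... [𝒮_{(i,s)(1)}(𝓕)] ... ]  (j = 1 applied first)
shiftAll : ∀ {m} → Fin m → ℕ → Family m → Family m
shiftAll {m} i s 𝓕 = foldl (λ 𝓖 j → shiftFam i s j 𝓖) 𝓕 (allFin m)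

IsFullStar : ∀ {m} → ℕ → ℕ → Family m → Set
IsFullStar {m} t k 𝓕 =
  Data.Product.Σ (Multiset m) λ X → card X ≡ t ×
    (∀ A → (A ∈ 𝓕 → card A ≡ k × X ⊆ₘ A) × (card A ≡ k × X ⊆ₘ A → A ∈ 𝓕))

-- The shifts are undone one at a time.  Write s = m(i,T) and let 𝒮 be a single shift 𝒮_{(i,s)(j)}.
-- 𝒮 keeps the family k-uniform, and it keeps T a kernel: as m(i,T) = s and m(j,T) ≥ 1, inside T a
-- moved set gives up at most s copies of i and gets back s − 1 copies of i and at least one of j.
-- So it suffices that 𝓖 is a full star whenever 𝒮(𝓖) is the full star of some X.  Let W be the
-- member of that star carrying all k − t spare copies on j.  If m(j,X) = 0, a moved member of 𝓖
-- would contain X and so lie in 𝒮(𝓖), whose j-free members are unmoved members of 𝓖; if W ∈ 𝓖,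
-- the kernel inequality for W and a j-free member fails.  In both cases nothing moves and 𝓖 = 𝒮(𝓖).
-- Otherwise W = sh C for a moved C ∈ 𝓖, and comparing any A ∈ 𝓖 with C inside T forces m(i,X) = s − 1,
-- m(j,X) = 1 and m(i,A) ≥ s: 𝓖 is the full star of X with its copy of j moved to i.

module Submission where

open import Defs
open import Data.Nat using (ℕ; suc; _+_; _*_; _∸_; _⊓_; _≤_; z≤n; s≤s; s≤s⁻¹; _≤?_)
import Data.Nat as ℕ
open import Data.Nat.Properties
open import Data.Nat.Solver using (module +-*-Solver)
open +-*-Solver using (solve; _:+_; _:=_)
open import Data.Fin using (Fin)
import Data.Fin as Fin
open import Data.Vec using (Vec; []; _∷_; lookup; sum; tabulate; _[_]≔_)
import Data.Vec.Properties as Vecₚ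
open import Data.List using ([]; _∷_; foldl; allFin)
open import Data.List.Properties using (map-id-local)
import Data.List.Relation.Unary.All as All
import Data.List.Relation.Unary.All.Properties as Allₚ
open import Data.List.Membership.Propositional.Properties using (∈-map⁺; ∈-map⁻)
open import Data.Product using (_×_; _,_; proj₁; proj₂)
open import Data.Empty using (⊥-elim)
open import Function using (_∘_)
open import Relation.Nullary using (Dec; yes; no)
open import Relation.Binary.PropositionalEquality

sum-mono : ∀ {n} {U V : Vec ℕ n} → (∀ l → lookup U l ≤ lookup V l) → sum U ≤ sum V
sum-mono {U = []}    {[]}    _   = z≤n
sum-mono {U = _ ∷ U} {_ ∷ V} U≤V = +-mono-≤ (U≤V Fin.zero) (sum-mono {U = U} {V} (U≤V ∘ Fin.suc))

sum-[]≔ : ∀ {n} (U : Vec ℕ n) a x → sum (U [ a ]≔ x) + lookup U a ≡ sum U + x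
sum-[]≔ (u ∷ U) Fin.zero    x = solve 3 (λ x S u → x :+ S :+ u := u :+ S :+ x) refl x (sum U) u
sum-[]≔ (u ∷ U) (Fin.suc a) x = begin
  u + sum (U [ a ]≔ x) + lookup U a   ≡⟨ +-assoc u _ _ ⟩
  u + (sum (U [ a ]≔ x) + lookup U a) ≡⟨ cong (u +_) (sum-[]≔ U a x) ⟩
  u + (sum U + x)                     ≡⟨ +-assoc u _ _ ⟨
  u + sum U + x                       ∎
  where open ≡-Reasoning

lookup-ext : ∀ {n} {U V : Vec ℕ n} → (∀ l → lookup U l ≡ lookup V l) → U ≡ V
lookup-ext {U = U} {V} U≗V = begin
  U                   ≡⟨ Vecₚ.tabulate∘lookup U ⟨
  tabulate (lookup U) ≡⟨ Vecₚ.tabulate-cong U≗V ⟩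
  tabulate (lookup V) ≡⟨ Vecₚ.tabulate∘lookup V ⟩
  V                   ∎
  where open ≡-Reasoning

mult-∩ : ∀ {m} l (A B : Multiset m) → mult l (A ∩ B) ≡ mult l A ⊓ mult l B
mult-∩ l A B = Vecₚ.lookup-zipWith _⊓_ l A B

∩-comm : ∀ {m} (A B : Multiset m) → A ∩ B ≡ B ∩ A
∩-comm A B = Vecₚ.zipWith-comm ⊓-comm A B

IsStarOf : ∀ {m} → ℕ → Multiset m → Family m → Set
IsStarOf k X 𝓕 = ∀ A → (A ∈ 𝓕 → card A ≡ k × X ⊆ₘ A) × (card A ≡ k × X ⊆ₘ A → A ∈ 𝓕)

shiftFam-fixed : ∀ {m} {i j : Fin m} {s} {𝓖 : Family m} →
  (∀ {D} → D ∈ 𝓖 → shiftOne i s j 𝓖 D ≡ D) → shiftFam i s j 𝓖 ≡ 𝓖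
shiftFam-fixed all-fixed = map-id-local (All.tabulate all-fixed)

module Pair {m : ℕ} {i j : Fin m} (i≢j : i ≢ j) where

  _⟨_,_⟩ : Multiset m → ℕ → ℕ → Multiset m
  A ⟨ x , y ⟩ = (A [ i ]≔ x) [ j ]≔ y

  pairMult : Multiset m → ℕ
  pairMult A = mult i A + mult j A

  offCard : Multiset m → ℕ
  offCard A = card (A ⟨ 0 , 0 ⟩)

  infix 4 _≤off_
  record _≤off_ (A B : Multiset m) : Set where
    constructor off≤
    field ≤-at : ∀ l → l ≢ i → l ≢ j → mult l A ≤ mult l B
  open _≤off_ public

  ≤off-refl : ∀ {A} → A ≤off A
  ≤off-refl = off≤ λ _ _ _ → ≤-refl

  ≤off-trans : ∀ {A B C} → A ≤off B → B ≤off C → A ≤off C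
  ≤off-trans A≤B B≤C = off≤ λ l l≢i l≢j → ≤-trans (≤-at A≤B l l≢i l≢j) (≤-at B≤C l l≢i l≢j)

  by-cases : {P : Fin m → Set} → P i → P j → (∀ l → l ≢ i → l ≢ j → P l) → ∀ l → P l
  by-cases Pᵢ Pⱼ Pₗ l with l Fin.≟ i | l Fin.≟ j
  ... | yes refl | _        = Pᵢ
  ... | no _     | yes refl = Pⱼ
  ... | no l≢i   | no l≢j   = Pₗ l l≢i l≢j

  ⊆ₘ-by-cases : ∀ X A → mult i X ≤ mult i A → mult j X ≤ mult j A → X ≤off A → X ⊆ₘ A
  ⊆ₘ-by-cases _ _ Xᵢ≤ Xⱼ≤ X≤A = by-cases Xᵢ≤ Xⱼ≤ (≤-at X≤A)

  ⊆ₘ⇒≤off : ∀ {X A} → X ⊆ₘ A → X ≤off A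
  ⊆ₘ⇒≤off X⊆A = off≤ λ l _ _ → X⊆A l

  ≡-by-cases : ∀ {A B} → mult i A ≡ mult i B → mult j A ≡ mult j B →
    (∀ l → l ≢ i → l ≢ j → mult l A ≡ mult l B) → A ≡ B
  ≡-by-cases Aᵢ≡ Aⱼ≡ Aₗ≡ = lookup-ext (by-cases Aᵢ≡ Aⱼ≡ Aₗ≡)

  mult-⟨⟩-i : ∀ A x y → mult i (A ⟨ x , y ⟩) ≡ x
  mult-⟨⟩-i A x y = trans (Vecₚ.lookup∘update′ i≢j (A [ i ]≔ x) y) (Vecₚ.lookup∘update i A x)

  mult-⟨⟩-j : ∀ A x y → mult j (A ⟨ x , y ⟩) ≡ y
  mult-⟨⟩-j A x y = Vecₚ.lookup∘update j (A [ i ]≔ x) y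

  mult-⟨⟩-off : ∀ A x y l → l ≢ i → l ≢ j → mult l (A ⟨ x , y ⟩) ≡ mult l A
  mult-⟨⟩-off A x y l l≢i l≢j =
    trans (Vecₚ.lookup∘update′ l≢j (A [ i ]≔ x) y) (Vecₚ.lookup∘update′ l≢i A x)

  ⟨⟩-≤off : ∀ A x y → A ⟨ x , y ⟩ ≤off A
  ⟨⟩-≤off A x y = off≤ λ l l≢i l≢j → ≤-reflexive (mult-⟨⟩-off A x y l l≢i l≢j)

  ≤off-⟨⟩ : ∀ A x y → A ≤off A ⟨ x , y ⟩
  ≤off-⟨⟩ A x y = off≤ λ l l≢i l≢j → ≤-reflexive (sym (mult-⟨⟩-off A x y l l≢i l≢j))

  card≡offCard+pairMult : ∀ A → card A ≡ offCard A + pairMult A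
  card≡offCard+pairMult A = begin
    card A                                       ≡⟨ +-identityʳ _ ⟨
    card A + 0                                   ≡⟨ sum-[]≔ A i 0 ⟨
    sum (A [ i ]≔ 0) + mult i A                  ≡⟨ cong (_+ mult i A) (+-identityʳ _) ⟨
    sum (A [ i ]≔ 0) + 0 + mult i A              ≡⟨ cong (_+ mult i A) (sum-[]≔ (A [ i ]≔ 0) j 0) ⟨
    offCard A + lookup (A [ i ]≔ 0) j + mult i A ≡⟨ cong (λ y → offCard A + y + mult i A)
                                                         (Vecₚ.lookup∘update′ (i≢j ∘ sym) A 0) ⟩
    offCard A + mult j A + mult i A              ≡⟨ +-assoc (offCard A) _ _ ⟩
    offCard A + (mult j A + mult i A)            ≡⟨ cong (offCard A +_) (+-comm (mult j A) _) ⟩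
    offCard A + pairMult A                       ∎
    where open ≡-Reasoning

  offCard-mono : ∀ {A B} → A ≤off B → offCard A ≤ offCard B
  offCard-mono {A} {B} A≤B = sum-mono {U = A ⟨ 0 , 0 ⟩} {B ⟨ 0 , 0 ⟩} (by-cases {P = P}
    (≤-reflexive (trans (mult-⟨⟩-i A 0 0) (sym (mult-⟨⟩-i B 0 0))))
    (≤-reflexive (trans (mult-⟨⟩-j A 0 0) (sym (mult-⟨⟩-j B 0 0))))
    (≤-at (≤off-trans (⟨⟩-≤off A 0 0) (≤off-trans A≤B (≤off-⟨⟩ B 0 0)))))
    where
    P : Fin m → Set
    P l = mult l (A ⟨ 0 , 0 ⟩) ≤ mult l (B ⟨ 0 , 0 ⟩)

  card-⟨⟩ : ∀ A x y → card (A ⟨ x , y ⟩) ≡ offCard A + (x + y)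
  card-⟨⟩ A x y = begin
    card (A ⟨ x , y ⟩)                              ≡⟨ card≡offCard+pairMult (A ⟨ x , y ⟩) ⟩
    offCard (A ⟨ x , y ⟩) + pairMult (A ⟨ x , y ⟩) ≡⟨ cong₂ _+_ offCard≡ pairMult≡ ⟩
    offCard A + (x + y)                             ∎
    where
    open ≡-Reasoning
    offCard≡ : offCard (A ⟨ x , y ⟩) ≡ offCard A
    offCard≡ = ≤-antisym (offCard-mono (⟨⟩-≤off A x y)) (offCard-mono (≤off-⟨⟩ A x y))
    pairMult≡ : pairMult (A ⟨ x , y ⟩) ≡ x + y
    pairMult≡ = cong₂ _+_ (mult-⟨⟩-i A x y) (mult-⟨⟩-j A x y)

  card-≤-offCard : ∀ {A B} → A ≤off B → card A ≤ offCard B + pairMult A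
  card-≤-offCard {A} A≤B =
    ≤-trans (≤-reflexive (card≡offCard+pairMult A)) (+-monoˡ-≤ (pairMult A) (offCard-mono A≤B))

  card-mono : ∀ {A B} → A ≤off B → pairMult A ≤ pairMult B → card A ≤ card B
  card-mono {A} {B} A≤B pair≤ = begin
    card A                 ≤⟨ card-≤-offCard A≤B ⟩
    offCard B + pairMult A ≤⟨ +-monoʳ-≤ (offCard B) pair≤ ⟩
    offCard B + pairMult B ≡⟨ card≡offCard+pairMult B ⟨
    card B                 ∎
    where open ≤-Reasoning

module Shifting {m : ℕ} (i : Fin m) (r : ℕ) (j : Fin m) where

  -- The paper's s is suc r, so that s − 1 reduces to r; for j ∉ F and s ≤ m(i,F), sh F is F_{(i,s)(j)}.
  sh : Multiset m → Multiset m
  sh F = (F [ i ]≔ r) [ j ]≔ (mult i F ∸ r)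

  𝒮 : Family m → Multiset m → Multiset m
  𝒮 = shiftOne i (suc r) j

  data ShiftCase (𝓖 : Family m) (F SF : Multiset m) : Set where
    shifted : mult j F ≡ 0 → suc r ≤ mult i F → SF ≡ sh F → ShiftCase 𝓖 F SF
    fixed   : SF ≡ F → (mult j F ≡ 0 → suc r ≤ mult i F → sh F ∈ 𝓖) → ShiftCase 𝓖 F SF

  shiftCase : ∀ 𝓖 F → ShiftCase 𝓖 F (𝒮 𝓖 F)
  shiftCase 𝓖 F with mult j F ℕ.≟ 0 | shiftM i (suc r) j F ∈? 𝓖
  ... | no Fⱼ≢0  | _ = fixed refl (λ Fⱼ≡0 → ⊥-elim (Fⱼ≢0 Fⱼ≡0))
  ... | yes Fⱼ≡0 | yes shiftM∈ with suc r ≤? mult i F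
  ...   | yes _    = fixed refl (λ _ _ → shiftM∈)
  ...   | no r≮Fᵢ = fixed refl (λ _ r<Fᵢ → ⊥-elim (r≮Fᵢ r<Fᵢ))
  shiftCase 𝓖 F | yes Fⱼ≡0 | no _ with suc r ≤? mult i F | mult j F ℕ.≟ 0
  ...   | yes r<Fᵢ | yes _    = shifted Fⱼ≡0 r<Fᵢ refl
  ...   | yes _    | no Fⱼ≢0 = ⊥-elim (Fⱼ≢0 Fⱼ≡0)
  ...   | no r≮Fᵢ  | _        = fixed refl (λ _ r<Fᵢ → ⊥-elim (r≮Fᵢ r<Fᵢ))

  shiftFam-diagonal : i ≡ j → ∀ 𝓖 → shiftFam i (suc r) j 𝓖 ≡ 𝓖
  shiftFam-diagonal i≡j 𝓖 = shiftFam-fixed λ {D} _ → fixed-on-diagonal D (shiftCase 𝓖 D)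
    where
    fixed-on-diagonal : ∀ D → ShiftCase 𝓖 D (𝒮 𝓖 D) → 𝒮 𝓖 D ≡ D
    fixed-on-diagonal D (fixed SD≡D _)         = SD≡D
    fixed-on-diagonal D (shifted Dⱼ≡0 r<Dᵢ _) =
      ⊥-elim (<⇒≢ (≤-trans (s≤s z≤n) (subst (λ l → suc r ≤ mult l D) i≡j r<Dᵢ)) (sym Dⱼ≡0))

  module Distinct (i≢j : i ≢ j) where

    open Pair i≢j public

    mult-sh-i : ∀ F → mult i (sh F) ≡ r
    mult-sh-i F = mult-⟨⟩-i F r _

    sh-pos-j : ∀ F → suc r ≤ mult i F → 1 ≤ mult j (sh F)
    sh-pos-j F r<Fᵢ = subst (1 ≤_) (sym (mult-⟨⟩-j F r _)) (m<n⇒0<n∸m r<Fᵢ)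

    sh-≤off : ∀ F → sh F ≤off F
    sh-≤off F = ⟨⟩-≤off F r _

    ≤off-sh : ∀ F → F ≤off sh F
    ≤off-sh F = ≤off-⟨⟩ F r _

    card-sh : ∀ F → mult j F ≡ 0 → r ≤ mult i F → card (sh F) ≡ card F
    card-sh F Fⱼ≡0 r≤Fᵢ = begin
      card (sh F)                    ≡⟨ card-⟨⟩ F r _ ⟩
      offCard F + (r + (mult i F ∸ r)) ≡⟨ cong (offCard F +_) (m+[n∸m]≡n r≤Fᵢ) ⟩
      offCard F + mult i F           ≡⟨ cong (offCard F +_) (+-identityʳ _) ⟨
      offCard F + (mult i F + 0)     ≡⟨ cong (λ y → offCard F + (mult i F + y)) Fⱼ≡0 ⟨
      offCard F + pairMult F         ≡⟨ card≡offCard+pairMult F ⟨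
      card F                         ∎
      where open ≡-Reasoning

    sh-injective : ∀ A B → mult j A ≡ 0 → r ≤ mult i A → mult j B ≡ 0 → r ≤ mult i B →
      sh A ≡ sh B → A ≡ B
    sh-injective A B Aⱼ≡0 r≤Aᵢ Bⱼ≡0 r≤Bᵢ shA≡shB =
      ≡-by-cases Aᵢ≡Bᵢ (trans Aⱼ≡0 (sym Bⱼ≡0)) Aₗ≡Bₗ
      where
      open ≡-Reasoning
      Aᵢ≡Bᵢ : mult i A ≡ mult i B
      Aᵢ≡Bᵢ = begin
        mult i A              ≡⟨ m+[n∸m]≡n r≤Aᵢ ⟨
        r + (mult i A ∸ r)    ≡⟨ cong (r +_) (mult-⟨⟩-j A r _) ⟨
        r + mult j (sh A)     ≡⟨ cong (λ C → r + mult j C) shA≡shB ⟩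
        r + mult j (sh B)     ≡⟨ cong (r +_) (mult-⟨⟩-j B r _) ⟩
        r + (mult i B ∸ r)    ≡⟨ m+[n∸m]≡n r≤Bᵢ ⟩
        mult i B              ∎
      Aₗ≡Bₗ : ∀ l → l ≢ i → l ≢ j → mult l A ≡ mult l B
      Aₗ≡Bₗ l l≢i l≢j = begin
        mult l A              ≡⟨ mult-⟨⟩-off A r _ l l≢i l≢j ⟨
        mult l (sh A)         ≡⟨ cong (mult l) shA≡shB ⟩
        mult l (sh B)         ≡⟨ mult-⟨⟩-off B r _ l l≢i l≢j ⟩
        mult l B              ∎

    𝒮-≤off : ∀ 𝓖 F → 𝒮 𝓖 F ≤off F
    𝒮-≤off 𝓖 F with shiftCase 𝓖 F
    ... | shifted _ _ SF≡shF = subst (_≤off F) (sym SF≡shF) (sh-≤off F)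
    ... | fixed SF≡F _       = subst (_≤off F) (sym SF≡F) ≤off-refl

    card-𝒮 : ∀ 𝓖 F → card (𝒮 𝓖 F) ≡ card F
    card-𝒮 𝓖 F with shiftCase 𝓖 F
    ... | shifted Fⱼ≡0 r<Fᵢ SF≡shF = trans (cong card SF≡shF) (card-sh F Fⱼ≡0 (<⇒≤ r<Fᵢ))
    ... | fixed SF≡F _             = cong card SF≡F

    shiftFam-kFamily : ∀ {k 𝓖} → IsKFamily k 𝓖 → IsKFamily k (shiftFam i (suc r) j 𝓖)
    shiftFam-kFamily {𝓖 = 𝓖} 𝓖-k = Allₚ.map⁺ (All.map (λ {F} |F|≡k → trans (card-𝒮 𝓖 F) |F|≡k) 𝓖-k)

    module Kernel (T : Multiset m) (Tᵢ≡ : mult i T ≡ suc r) where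

      κ : Multiset m → Multiset m → Multiset m
      κ A B = (A ∩ B) ∩ T

      mult-κ : ∀ l A B → mult l (κ A B) ≡ (mult l A ⊓ mult l B) ⊓ mult l T
      mult-κ l A B = trans (mult-∩ l (A ∩ B) T) (cong (_⊓ mult l T) (mult-∩ l A B))

      card-κ-comm : ∀ A B → card (κ A B) ≡ card (κ B A)
      card-κ-comm A B = cong (λ C → card (C ∩ T)) (∩-comm A B)

      κ-mono-≤off : ∀ {A A′ B B′} → A ≤off A′ → B ≤off B′ → κ A B ≤off κ A′ B′
      κ-mono-≤off {A} {A′} {B} {B′} A≤ B≤ = off≤ λ l l≢i l≢j → begin
        mult l (κ A B)                      ≡⟨ mult-κ l A B ⟩
        (mult l A ⊓ mult l B) ⊓ mult l T   ≤⟨ ⊓-mono-≤ (⊓-mono-≤ (≤-at A≤ l l≢i l≢j) (≤-at B≤ l l≢i l≢j))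
                                                         ≤-refl ⟩
        (mult l A′ ⊓ mult l B′) ⊓ mult l T ≡⟨ mult-κ l A′ B′ ⟨
        mult l (κ A′ B′)                    ∎
        where open ≤-Reasoning

      κ-≤offˡ : ∀ {A B C} → A ≤off C → κ A B ≤off C
      κ-≤offˡ {A} {B} {C} A≤C = off≤ λ l l≢i l≢j → begin
        mult l (κ A B)                     ≡⟨ mult-κ l A B ⟩
        (mult l A ⊓ mult l B) ⊓ mult l T  ≤⟨ ≤-trans (m⊓n≤m _ _) (m⊓n≤m _ _) ⟩
        mult l A                           ≤⟨ ≤-at A≤C l l≢i l≢j ⟩
        mult l C                           ∎
        where open ≤-Reasoning

      κ-≤offʳ : ∀ {A B C} → B ≤off C → κ A B ≤off C
      κ-≤offʳ {A} {B} {C} B≤C = off≤ λ l l≢i l≢j → begin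
        mult l (κ A B)                     ≡⟨ mult-κ l A B ⟩
        (mult l A ⊓ mult l B) ⊓ mult l T  ≤⟨ ≤-trans (m⊓n≤m _ _) (m⊓n≤n _ _) ⟩
        mult l B                           ≤⟨ ≤-at B≤C l l≢i l≢j ⟩
        mult l C                           ∎
        where open ≤-Reasoning

      pairMult-κ-≤ : ∀ A {B} → mult j B ≡ 0 → pairMult (κ A B) ≤ mult i A ⊓ suc r
      pairMult-κ-≤ A {B} Bⱼ≡0 = ≤-trans (+-mono-≤ κᵢ≤ κⱼ≤0) (≤-reflexive (+-identityʳ _))
        where
        κᵢ≤ : mult i (κ A B) ≤ mult i A ⊓ suc r
        κᵢ≤ = ≤-trans (≤-reflexive (mult-κ i A B)) (⊓-mono-≤ (m⊓n≤m _ _) (≤-reflexive Tᵢ≡))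
        κⱼ≤0 : mult j (κ A B) ≤ 0
        κⱼ≤0 = ≤-trans (≤-reflexive (mult-κ j A B))
                       (≤-trans (m⊓n≤m _ _) (≤-trans (m⊓n≤n _ _) (≤-reflexive Bⱼ≡0)))

      mult-i-κ-sh : ∀ A B → mult i (κ A (sh B)) ≡ mult i A ⊓ r
      mult-i-κ-sh A B = begin
        mult i (κ A (sh B))                   ≡⟨ mult-κ i A (sh B) ⟩
        (mult i A ⊓ mult i (sh B)) ⊓ mult i T ≡⟨ cong₂ (λ x y → (mult i A ⊓ x) ⊓ y) (mult-sh-i B) Tᵢ≡ ⟩
        (mult i A ⊓ r) ⊓ suc r                ≡⟨ m≤n⇒m⊓n≡m (≤-trans (m⊓n≤n _ r) (n≤1+n r)) ⟩
        mult i A ⊓ r                          ∎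
        where open ≡-Reasoning

      mult-j-κ-sh-pos : ∀ A B → 1 ≤ mult j T → 1 ≤ mult j A → suc r ≤ mult i B →
        1 ≤ mult j (κ A (sh B))
      mult-j-κ-sh-pos A B 1≤Tⱼ 1≤Aⱼ r<Bᵢ =
        subst (1 ≤_) (sym (mult-κ j A (sh B))) (⊓-glb (⊓-glb 1≤Aⱼ (sh-pos-j B r<Bᵢ)) 1≤Tⱼ)

      -- The partner B of a moved set A either has j or was moved as well (full), has fewer than s copies
      -- of i (small), or stayed because sh B ∈ 𝓖 (swap); in each case sh A loses nothing inside T.
      κ-sh-≥-full : ∀ A {B B′} → 1 ≤ mult j T → mult j A ≡ 0 → suc r ≤ mult i A →
        B ≤off B′ → r ≤ mult i B′ → 1 ≤ mult j B′ → card (κ B A) ≤ card (κ B′ (sh A))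
      κ-sh-≥-full A {B} {B′} 1≤Tⱼ Aⱼ≡0 r<Aᵢ B≤B′ r≤B′ᵢ 1≤B′ⱼ =
        card-mono (κ-mono-≤off B≤B′ (≤off-sh A)) (begin
          pairMult (κ B A)        ≤⟨ pairMult-κ-≤ B Aⱼ≡0 ⟩
          mult i B ⊓ suc r        ≤⟨ m⊓n≤n _ _ ⟩
          suc r                   ≡⟨ +-comm 1 r ⟩
          r + 1                   ≤⟨ +-mono-≤ (≤-reflexive (sym κᵢ≡r))
                                              (mult-j-κ-sh-pos B′ A 1≤Tⱼ 1≤B′ⱼ r<Aᵢ) ⟩
          pairMult (κ B′ (sh A))  ∎)
        where
        open ≤-Reasoning
        κᵢ≡r : mult i (κ B′ (sh A)) ≡ r
        κᵢ≡r = trans (mult-i-κ-sh B′ A) (m≥n⇒m⊓n≡n r≤B′ᵢ)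

      κ-sh-≥-small : ∀ A B → mult j A ≡ 0 → mult i B ≤ r → card (κ B A) ≤ card (κ B (sh A))
      κ-sh-≥-small A B Aⱼ≡0 Bᵢ≤r =
        card-mono (κ-mono-≤off (≤off-refl {B}) (≤off-sh A)) (begin
          pairMult (κ B A)       ≤⟨ pairMult-κ-≤ B Aⱼ≡0 ⟩
          mult i B ⊓ suc r       ≤⟨ m⊓n≤m _ _ ⟩
          mult i B               ≡⟨ trans (mult-i-κ-sh B A) (m≤n⇒m⊓n≡m Bᵢ≤r) ⟨
          mult i (κ B (sh A))    ≤⟨ m≤m+n _ _ ⟩
          pairMult (κ B (sh A))  ∎)
        where open ≤-Reasoning

      κ-sh-≥-swap : ∀ A B → mult j A ≡ 0 → r ≤ mult i B → card (κ (sh B) A) ≤ card (κ B (sh A))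
      κ-sh-≥-swap A B Aⱼ≡0 r≤Bᵢ =
        card-mono (κ-mono-≤off (sh-≤off B) (≤off-sh A)) (begin
          pairMult (κ (sh B) A)  ≤⟨ pairMult-κ-≤ (sh B) Aⱼ≡0 ⟩
          mult i (sh B) ⊓ suc r  ≤⟨ m⊓n≤m _ _ ⟩
          mult i (sh B)          ≡⟨ mult-sh-i B ⟩
          r                      ≡⟨ trans (mult-i-κ-sh B A) (m≥n⇒m⊓n≡n r≤Bᵢ) ⟨
          mult i (κ B (sh A))    ≤⟨ m≤m+n _ _ ⟩
          pairMult (κ B (sh A))  ∎)
        where open ≤-Reasoning

      kernel-with-shifted : ∀ {t 𝓖} → IsKernel t 𝓖 T → 1 ≤ mult j T →
        ∀ {A B} → A ∈ 𝓖 → B ∈ 𝓖 → mult j A ≡ 0 → suc r ≤ mult i A → t ≤ card (κ (𝒮 𝓖 B) (sh A))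
      kernel-with-shifted {t} {𝓖} ker 1≤Tⱼ {A} {B} A∈ B∈ Aⱼ≡0 r<Aᵢ with shiftCase 𝓖 B
      ... | shifted Bⱼ≡0 r<Bᵢ SB≡shB =
        subst (λ F → t ≤ card (κ F (sh A))) (sym SB≡shB)
          (≤-trans (ker B∈ A∈) (κ-sh-≥-full A 1≤Tⱼ Aⱼ≡0 r<Aᵢ (≤off-sh B)
                                  (≤-reflexive (sym (mult-sh-i B))) (sh-pos-j B r<Bᵢ)))
      ... | fixed SB≡B sh∈ =
        subst (λ F → t ≤ card (κ F (sh A))) (sym SB≡B) (with-fixed (suc r ≤? mult i B) (mult j B ℕ.≟ 0))
        where
        with-fixed : Dec (suc r ≤ mult i B) → Dec (mult j B ≡ 0) → t ≤ card (κ B (sh A))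
        with-fixed (no r≮Bᵢ) _           =
          ≤-trans (ker B∈ A∈) (κ-sh-≥-small A B Aⱼ≡0 (s≤s⁻¹ (≰⇒> r≮Bᵢ)))
        with-fixed (yes r<Bᵢ) (yes Bⱼ≡0) =
          ≤-trans (ker (sh∈ Bⱼ≡0 r<Bᵢ) A∈) (κ-sh-≥-swap A B Aⱼ≡0 (<⇒≤ r<Bᵢ))
        with-fixed (yes r<Bᵢ) (no Bⱼ≢0)  =
          ≤-trans (ker B∈ A∈) (κ-sh-≥-full A 1≤Tⱼ Aⱼ≡0 r<Aᵢ (≤off-refl {B}) (<⇒≤ r<Bᵢ) (n≢0⇒n>0 Bⱼ≢0))

      shiftFam-kernel : ∀ {t 𝓖} → IsKernel t 𝓖 T → 1 ≤ mult j T → IsKernel t (shiftFam i (suc r) j 𝓖) T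
      shiftFam-kernel {t} {𝓖} ker 1≤Tⱼ F₁∈ F₂∈ with ∈-map⁻ (𝒮 𝓖) F₁∈ | ∈-map⁻ (𝒮 𝓖) F₂∈
      ... | A , A∈ , refl | B , B∈ , refl with shiftCase 𝓖 A | shiftCase 𝓖 B
      ...   | shifted Aⱼ≡0 r<Aᵢ SA≡shA | _ =
        subst (λ F → t ≤ card (κ F (𝒮 𝓖 B))) (sym SA≡shA)
          (subst (t ≤_) (card-κ-comm (𝒮 𝓖 B) (sh A))
            (kernel-with-shifted ker 1≤Tⱼ A∈ B∈ Aⱼ≡0 r<Aᵢ))
      ...   | fixed SA≡A _ | shifted Bⱼ≡0 r<Bᵢ SB≡shB =
        subst (λ F → t ≤ card (κ (𝒮 𝓖 A) F)) (sym SB≡shB)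
          (kernel-with-shifted ker 1≤Tⱼ B∈ A∈ Bⱼ≡0 r<Bᵢ)
      ...   | fixed SA≡A _ | fixed SB≡B _ =
        subst₂ (λ F G → t ≤ card (κ F G)) (sym SA≡A) (sym SB≡B) (ker A∈ B∈)

    module Back {t k : ℕ} (t≤k : t ≤ k) (T : Multiset m) (Tᵢ≡ : mult i T ≡ suc r)
                {𝓖 : Family m} (𝓖-k : IsKFamily k 𝓖) (ker : IsKernel t 𝓖 T)
                (X : Multiset m) (|X|≡t : card X ≡ t) (star : IsStarOf k X (shiftFam i (suc r) j 𝓖)) where

      open Kernel T Tᵢ≡

      ∈𝒮𝓖 : ∀ A → card A ≡ k → X ⊆ₘ A → A ∈ shiftFam i (suc r) j 𝓖
      ∈𝒮𝓖 A |A|≡k X⊆A = proj₂ (star A) (|A|≡k , X⊆A)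

      X⊆𝒮 : ∀ {D} → D ∈ 𝓖 → X ⊆ₘ 𝒮 𝓖 D
      X⊆𝒮 D∈ = proj₂ (proj₁ (star _) (∈-map⁺ (𝒮 𝓖) D∈))

      unchanged : (∀ {D} → D ∈ 𝓖 → 𝒮 𝓖 D ≡ D) → IsFullStar t k 𝓖
      unchanged all-fixed = subst (IsFullStar t k) (shiftFam-fixed all-fixed) (X , |X|≡t , star)

      fixed-if-j-empty : ∀ {A} → A ∈ shiftFam i (suc r) j 𝓖 → mult j A ≡ 0 → 𝒮 𝓖 A ≡ A
      fixed-if-j-empty A∈ Aⱼ≡0 with ∈-map⁻ (𝒮 𝓖) A∈
      ... | D , _ , refl with shiftCase 𝓖 D
      ...   | shifted _ r<Dᵢ SD≡shD =
        ⊥-elim (<⇒≢ (sh-pos-j D r<Dᵢ) (sym (trans (cong (mult j) (sym SD≡shD)) Aⱼ≡0)))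
      ...   | fixed SD≡D _         = cong (𝒮 𝓖) SD≡D

      ∈𝓖-if-i-full : ∀ {A} → A ∈ shiftFam i (suc r) j 𝓖 → suc r ≤ mult i A → A ∈ 𝓖
      ∈𝓖-if-i-full A∈ r<Aᵢ with ∈-map⁻ (𝒮 𝓖) A∈
      ... | D , D∈ , refl with shiftCase 𝓖 D
      ...   | shifted _ _ SD≡shD =
        ⊥-elim (1+n≰n (≤-trans r<Aᵢ (≤-reflexive (trans (cong (mult i) SD≡shD) (mult-sh-i D)))))
      ...   | fixed SD≡D _       = subst (_∈ 𝓖) (sym SD≡D) D∈

      pairMult-X-≤ : ∀ {A B} → A ∈ 𝓖 → B ∈ 𝓖 → κ A B ≤off X → pairMult X ≤ pairMult (κ A B)
      pairMult-X-≤ {A} {B} A∈ B∈ κ≤X = +-cancelˡ-≤ (offCard X) _ _ (begin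
        offCard X + pairMult X   ≡⟨ card≡offCard+pairMult X ⟨
        card X                   ≡⟨ |X|≡t ⟩
        t                        ≤⟨ ker A∈ B∈ ⟩
        card (κ A B)             ≤⟨ card-≤-offCard κ≤X ⟩
        offCard X + pairMult (κ A B) ∎)
        where open ≤-Reasoning

      fixed-if-Xⱼ≡0 : mult j X ≡ 0 → ∀ {D} → D ∈ 𝓖 → 𝒮 𝓖 D ≡ D
      fixed-if-Xⱼ≡0 Xⱼ≡0 {D} D∈ with shiftCase 𝓖 D
      ... | fixed SD≡D _ = SD≡D
      ... | shifted Dⱼ≡0 r<Dᵢ SD≡shD = ⊥-elim (<⇒≢ (sh-pos-j D r<Dᵢ) (sym shDⱼ≡0))
        where
        X⊆shD : X ⊆ₘ sh D
        X⊆shD = subst (X ⊆ₘ_) SD≡shD (X⊆𝒮 D∈)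
        X⊆D : X ⊆ₘ D
        X⊆D = ⊆ₘ-by-cases X D (≤-trans (X⊆shD i) (≤-trans (≤-reflexive (mult-sh-i D)) (<⇒≤ r<Dᵢ)))
                              (≤-reflexive (trans Xⱼ≡0 (sym Dⱼ≡0)))
                              (≤off-trans (⊆ₘ⇒≤off X⊆shD) (sh-≤off D))
        shD≡D : sh D ≡ D
        shD≡D = trans (sym SD≡shD) (fixed-if-j-empty (∈𝒮𝓖 D (All.lookup 𝓖-k D∈) X⊆D) Dⱼ≡0)
        shDⱼ≡0 : mult j (sh D) ≡ 0
        shDⱼ≡0 = trans (cong (mult j) shD≡D) Dⱼ≡0

      -- A j-free member of 𝓖 meets W inside T in at most t − m(j,X) elements.
      W : Multiset m
      W = X ⟨ mult i X , mult j X + (k ∸ t) ⟩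

      W∈𝒮𝓖 : W ∈ shiftFam i (suc r) j 𝓖
      W∈𝒮𝓖 = ∈𝒮𝓖 W card-W X⊆W
        where
        open ≡-Reasoning
        reassociate : ∀ a b c d → a + (b + (c + d)) ≡ a + (b + c) + d
        reassociate = solve 4 (λ a b c d → a :+ (b :+ (c :+ d)) := a :+ (b :+ c) :+ d) refl
        card-W : card W ≡ k
        card-W = begin
          card W                                          ≡⟨ card-⟨⟩ X _ _ ⟩
          offCard X + (mult i X + (mult j X + (k ∸ t)))   ≡⟨ reassociate (offCard X) (mult i X) (mult j X) (k ∸ t) ⟩
          offCard X + pairMult X + (k ∸ t)               ≡⟨ cong (_+ (k ∸ t)) (sym (card≡offCard+pairMult X)) ⟩
          card X + (k ∸ t)                                ≡⟨ cong (_+ (k ∸ t)) |X|≡t ⟩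
          t + (k ∸ t)                                     ≡⟨ m+[n∸m]≡n t≤k ⟩
          k                                               ∎
        X⊆W : X ⊆ₘ W
        X⊆W = ⊆ₘ-by-cases X W (≤-reflexive (sym (mult-⟨⟩-i X _ _)))
                              (≤-trans (m≤m+n _ _) (≤-reflexive (sym (mult-⟨⟩-j X _ _))))
                              (≤off-⟨⟩ X _ _)

      fixed-if-W∈𝓖 : 1 ≤ mult j X → W ∈ 𝓖 → ∀ {D} → D ∈ 𝓖 → 𝒮 𝓖 D ≡ D
      fixed-if-W∈𝓖 1≤Xⱼ W∈ {D} D∈ with shiftCase 𝓖 D
      ... | fixed SD≡D _ = SD≡D
      ... | shifted Dⱼ≡0 _ _ = ⊥-elim (m+1+n≰m (mult i X) (begin
          mult i X + 1           ≤⟨ +-monoʳ-≤ (mult i X) 1≤Xⱼ ⟩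
          pairMult X             ≤⟨ pairMult-X-≤ W∈ D∈ (κ-≤offˡ (⟨⟩-≤off X _ _)) ⟩
          pairMult (κ W D)       ≤⟨ pairMult-κ-≤ W Dⱼ≡0 ⟩
          mult i W ⊓ suc r       ≤⟨ m⊓n≤m _ _ ⟩
          mult i W               ≡⟨ mult-⟨⟩-i X _ _ ⟩
          mult i X               ∎))
        where open ≤-Reasoning

      module ShiftedW {C : Multiset m} (C∈ : C ∈ 𝓖) (Cⱼ≡0 : mult j C ≡ 0) (W≡shC : W ≡ sh C)
                      (1≤Xⱼ : 1 ≤ mult j X) where

        Xᵢ≡r : mult i X ≡ r
        Xᵢ≡r = trans (sym (mult-⟨⟩-i X _ _)) (trans (cong (mult i) W≡shC) (mult-sh-i C))

        r+Xⱼ≤ : ∀ {A} → A ∈ 𝓖 → r + mult j X ≤ mult i A ⊓ suc r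
        r+Xⱼ≤ {A} A∈ = begin
          r + mult j X        ≡⟨ cong (_+ mult j X) Xᵢ≡r ⟨
          pairMult X          ≤⟨ pairMult-X-≤ A∈ C∈ (κ-≤offʳ C≤X) ⟩
          pairMult (κ A C)    ≤⟨ pairMult-κ-≤ A Cⱼ≡0 ⟩
          mult i A ⊓ suc r    ∎
          where
          open ≤-Reasoning
          C≤X : C ≤off X
          C≤X = ≤off-trans (≤off-sh C) (subst (_≤off X) W≡shC (⟨⟩-≤off X _ _))

        Xⱼ≡1 : mult j X ≡ 1
        Xⱼ≡1 = ≤-antisym (+-cancelˡ-≤ r _ _ r+Xⱼ≤r+1) 1≤Xⱼ
          where
          r+Xⱼ≤r+1 : r + mult j X ≤ r + 1
          r+Xⱼ≤r+1 = ≤-trans (r+Xⱼ≤ C∈) (≤-trans (m⊓n≤n _ _) (≤-reflexive (+-comm 1 r)))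

        i-full : ∀ {A} → A ∈ 𝓖 → suc r ≤ mult i A
        i-full {A} A∈ = begin
          suc r              ≡⟨ +-comm 1 r ⟩
          r + 1              ≡⟨ cong (r +_) Xⱼ≡1 ⟨
          r + mult j X       ≤⟨ r+Xⱼ≤ A∈ ⟩
          mult i A ⊓ suc r   ≤⟨ m⊓n≤m _ _ ⟩
          mult i A           ∎
          where open ≤-Reasoning

        X′ : Multiset m
        X′ = X ⟨ suc r , 0 ⟩

        card-X′ : card X′ ≡ t
        card-X′ = begin
          card X′                  ≡⟨ card-⟨⟩ X _ _ ⟩
          offCard X + (suc r + 0)  ≡⟨ cong (offCard X +_) (trans (+-identityʳ _) (+-comm 1 r)) ⟩
          offCard X + (r + 1)      ≡⟨ cong (offCard X +_) (cong₂ _+_ Xᵢ≡r Xⱼ≡1) ⟨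
          offCard X + pairMult X   ≡⟨ card≡offCard+pairMult X ⟨
          card X                   ≡⟨ |X|≡t ⟩
          t                        ∎
          where open ≡-Reasoning

        ∈𝓖⇒⊇X′ : ∀ {A} → A ∈ 𝓖 → card A ≡ k × X′ ⊆ₘ A
        ∈𝓖⇒⊇X′ {A} A∈ = All.lookup 𝓖-k A∈ , ⊆ₘ-by-cases X′ A
          (≤-trans (≤-reflexive (mult-⟨⟩-i X _ _)) (i-full A∈))
          (≤-trans (≤-reflexive (mult-⟨⟩-j X _ _)) z≤n)
          (≤off-trans (⟨⟩-≤off X (suc r) 0) (≤off-trans (⊆ₘ⇒≤off (X⊆𝒮 A∈)) (𝒮-≤off 𝓖 A)))

        j-occupied-∈𝓖 : ∀ {A} → card A ≡ k → suc r ≤ mult i A → 1 ≤ mult j A → X ≤off A → A ∈ 𝓖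
        j-occupied-∈𝓖 {A} |A|≡k r<Aᵢ 1≤Aⱼ X≤A = ∈𝓖-if-i-full (∈𝒮𝓖 A |A|≡k X⊆A) r<Aᵢ
          where
          X⊆A : X ⊆ₘ A
          X⊆A = ⊆ₘ-by-cases X A (≤-trans (≤-reflexive Xᵢ≡r) (<⇒≤ r<Aᵢ))
                                (≤-trans (≤-reflexive Xⱼ≡1) 1≤Aⱼ) X≤A

        j-empty-∈𝓖 : ∀ {A} → card A ≡ k → suc r ≤ mult i A → mult j A ≡ 0 → X ≤off A → A ∈ 𝓖
        j-empty-∈𝓖 {A} |A|≡k r<Aᵢ Aⱼ≡0 X≤A with ∈-map⁻ (𝒮 𝓖) (∈𝒮𝓖 (sh A) |shA|≡k X⊆shA)
          where
          |shA|≡k : card (sh A) ≡ k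
          |shA|≡k = trans (card-sh A Aⱼ≡0 (<⇒≤ r<Aᵢ)) |A|≡k
          X⊆shA : X ⊆ₘ sh A
          X⊆shA = ⊆ₘ-by-cases X (sh A) (≤-reflexive (trans Xᵢ≡r (sym (mult-sh-i A))))
                                       (≤-trans (≤-reflexive Xⱼ≡1) (sh-pos-j A r<Aᵢ))
                                       (≤off-trans X≤A (≤off-sh A))
        ... | D , D∈ , shA≡SD with shiftCase 𝓖 D
        ...   | shifted Dⱼ≡0 r<Dᵢ SD≡shD =
          subst (_∈ 𝓖) (sh-injective D A Dⱼ≡0 (<⇒≤ r<Dᵢ) Aⱼ≡0 (<⇒≤ r<Aᵢ)
                                     (sym (trans shA≡SD SD≡shD))) D∈
        ...   | fixed SD≡D _ =
          ⊥-elim (1+n≰n (≤-trans (i-full shA∈) (≤-reflexive (mult-sh-i A))))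
          where
          shA∈ : sh A ∈ 𝓖
          shA∈ = subst (_∈ 𝓖) (sym (trans shA≡SD SD≡D)) D∈

        ⊇X′⇒∈𝓖 : ∀ {A} → card A ≡ k × X′ ⊆ₘ A → A ∈ 𝓖
        ⊇X′⇒∈𝓖 {A} (|A|≡k , X′⊆A) = by-j (mult j A ℕ.≟ 0)
          where
          r<Aᵢ : suc r ≤ mult i A
          r<Aᵢ = ≤-trans (≤-reflexive (sym (mult-⟨⟩-i X _ _))) (X′⊆A i)
          X≤A : X ≤off A
          X≤A = ≤off-trans (≤off-⟨⟩ X (suc r) 0) (⊆ₘ⇒≤off X′⊆A)
          by-j : Dec (mult j A ≡ 0) → A ∈ 𝓖
          by-j (yes Aⱼ≡0) = j-empty-∈𝓖 |A|≡k r<Aᵢ Aⱼ≡0 X≤A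
          by-j (no Aⱼ≢0)  = j-occupied-∈𝓖 |A|≡k r<Aᵢ (n≢0⇒n>0 Aⱼ≢0) X≤A

        fullStar : IsFullStar t k 𝓖
        fullStar = X′ , card-X′ , λ A → ∈𝓖⇒⊇X′ , ⊇X′⇒∈𝓖

      fullStar : IsFullStar t k 𝓖
      fullStar with mult j X ℕ.≟ 0
      ... | yes Xⱼ≡0 = unchanged (fixed-if-Xⱼ≡0 Xⱼ≡0)
      ... | no Xⱼ≢0 with ∈-map⁻ (𝒮 𝓖) W∈𝒮𝓖
      ...   | C , C∈ , W≡SC with shiftCase 𝓖 C
      ...     | fixed SC≡C _ =
        unchanged (fixed-if-W∈𝓖 (n≢0⇒n>0 Xⱼ≢0) (subst (_∈ 𝓖) (sym (trans W≡SC SC≡C)) C∈))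
      ...     | shifted Cⱼ≡0 _ SC≡shC =
        ShiftedW.fullStar C∈ Cⱼ≡0 (trans W≡SC SC≡shC) (n≢0⇒n>0 Xⱼ≢0)

shift-step : ∀ {m t k} {T : Multiset m} {i : Fin m} {r} → t ≤ k → mult i T ≡ suc r →
  ∀ j → 1 ≤ mult j T → ∀ {𝓖} → IsKFamily k 𝓖 → IsKernel t 𝓖 T →
  (IsKFamily k (shiftFam i (suc r) j 𝓖) × IsKernel t (shiftFam i (suc r) j 𝓖) T) ×
  (IsFullStar t k (shiftFam i (suc r) j 𝓖) → IsFullStar t k 𝓖)
shift-step {T = T} {i} {r} t≤k Tᵢ≡ j 1≤Tⱼ {𝓖} 𝓖-k ker with i Fin.≟ j
... | yes i≡j rewrite Shifting.shiftFam-diagonal i r j i≡j 𝓖 = (𝓖-k , ker) , λ full → full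
... | no i≢j =
  (shiftFam-kFamily 𝓖-k , Kernel.shiftFam-kernel T Tᵢ≡ ker 1≤Tⱼ) ,
  λ (X , |X|≡t , star) → Back.fullStar t≤k T Tᵢ≡ 𝓖-k ker X |X|≡t star
  where open Shifting.Distinct i r j i≢j

shiftAll-back : ∀ {m t k} {T : Multiset m} {i : Fin m} {r} → t ≤ k → mult i T ≡ suc r →
  (∀ l → 1 ≤ mult l T) → ∀ js {𝓖} → IsKFamily k 𝓖 → IsKernel t 𝓖 T →
  IsFullStar t k (foldl (λ 𝓗 j → shiftFam i (suc r) j 𝓗) 𝓖 js) → IsFullStar t k 𝓖
shiftAll-back t≤k Tᵢ≡ T⁺ []       _   _   full = full
shiftAll-back t≤k Tᵢ≡ T⁺ (j ∷ js) 𝓖-k ker full =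
  let ((𝓖′-k , ker′) , back) = shift-step t≤k Tᵢ≡ j (T⁺ j) 𝓖-k ker
  in back (shiftAll-back t≤k Tᵢ≡ T⁺ js 𝓖′-k ker′ full)

lemma4p7 : (t k m : ℕ) → 1 ≤ t → t ≤ k → 2 * k ∸ t ≤ m →
    (𝓕 : Family m) → IsKFamily k 𝓕 → IsTIntersecting t 𝓕 →
    (T : Multiset m) → InK t 𝓕 T →
    (i : Fin m) → 2 ≤ mult i T →
    IsFullStar t k (shiftAll i (mult i T) 𝓕) →
    IsFullStar t k 𝓕
lemma4p7 t k m _ t≤k _ 𝓕 𝓕-k _ T (ker , T⁺) i 2≤Tᵢ full with mult i T in Tᵢ≡
... | suc r = shiftAll-back t≤k Tᵢ≡ T⁺ (allFin m) 𝓕-k ker full
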